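{- Let $k>1$ and let $P\subseteq\{1,2,3\}^k$ be a strong uniquely solvable puzzle with $|P|=s$. Then there exists a strong uniquely solvable puzzle $P''\subseteq\{1,2,3\}^{k-1}$ with $|P''|=\lceil s/3\rceil$.
   Context: $[k]=\{1,\dots,k\}$. A puzzle of width $k$ is a finite set $P\subseteq\{1,2,3\}^k$ (elements are rows). $P$ is a strong uniquely solvable puzzle if for all $\pi_1,\pi_2,\pi_3\in\mathrm{Sym}(P)$, either (i) $\pi_1=\pi_2=\pi_3$, or (ii) there exist $r\in P$ and $c\in[k]$ such that exactly two of $(\pi_1(r))_c=1$, $(\pi_2(r))_c=2$, $(\pi_3(r))_c=3$ hold. -}

module Defs where

open import Data.Nat using (ℕ; _+_)
open import Data.Nat.DivMod using (_/_)
open import Data.Fin using (Fin; zero; suc)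
open import Data.Product using (Σ; ∃; ∃-syntax; _×_; _,_)
open import Data.Sum using (_⊎_)
open import Relation.Nullary using (¬_)
open import Relation.Binary.PropositionalEquality using (_≡_)
open import Function.Bundles using (_↔_; Inverse)
open import Function.Definitions using (Injective)

one two three : Fin 3
one = zero
two = suc zero
three = suc (suc zero)

Row : ℕ → Set
Row k = Fin k → Fin 3

-- A puzzle of width k with exactly s rows: a finite set P ⊆ {1,2,3}^k of
-- cardinality s, given by an injective enumeration of its rows.
record Puzzle (k s : ℕ) : Set where
  field
    row    : Fin s → Row k
    row-inj : Injective _≡_ _≡_ row
open Puzzle public

Perm : ℕ → Set
Perm s = Fin s ↔ Fin s

apply : ∀ {s} → Perm s → Fin s → Fin s
apply π = Inverse.to π

SamePerm : ∀ {s} → Perm s → Perm s → Set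
SamePerm π σ = ∀ i → apply π i ≡ apply σ i

ExactlyTwo : Set → Set → Set → Set
ExactlyTwo A B C = (A × B × ¬ C) ⊎ (A × ¬ B × C) ⊎ (¬ A × B × C)

IsStrongUSP : ∀ {k s} → Puzzle k s → Set
IsStrongUSP {k} {s} P =
  (π₁ π₂ π₃ : Perm s) →
    (SamePerm π₁ π₂ × SamePerm π₂ π₃)
    ⊎ (∃[ r ] ∃[ c ]
         ExactlyTwo (row P (apply π₁ r) c ≡ one)
                    (row P (apply π₂ r) c ≡ two)
                    (row P (apply π₃ r) c ≡ three))

ceil/3 : ℕ → ℕ
ceil/3 s = (s + 2) / 3

{-# OPTIONS --safe #-}
-- A strong USP stays strong when rows are removed (permutations of the kept rows extend to
-- permutations of all rows by fixing the others) and when a column constant on every row is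
-- deleted (such a column can never witness "exactly two"). By pigeonhole, some symbol fills
-- the first column in at least ⌈s/3⌉ rows; keep those rows and delete the first column.
module Submission where

open import Defs
open import Data.Nat using (ℕ; suc; _<_; _∸_)
open import Data.Product using (Σ; ∃; ∃-syntax; _×_; _,_)

open import Data.Empty using (⊥-elim)
open import Data.Fin using (Fin; zero; suc; _≟_; inject≤; punchIn; punchOut)
open import Data.Fin.Permutation using (id; flip; transpose; _⟨$⟩ʳ_; _⟨$⟩ˡ_; inverseʳ)
import Data.Fin.Permutation.Components as Components
open import Data.Fin.Properties using (any?; suc-injective; inject≤-injective; punchIn-punchOut)
import Data.Nat as ℕ
open import Data.Nat.DivMod using (m/n*n≤m)
import Data.Nat.Properties as ℕ
open import Data.Nat.Tactic.RingSolver using (solve-∀)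
open import Data.Sum using (_⊎_; inj₁; inj₂)
open import Function using (_∘_)
open import Function.Bundles using (mk↔ₛ′)
open import Function.Definitions using (Injective)
open import Level using (0ℓ)
open import Relation.Nullary using (¬_; Dec; yes; no)
open import Relation.Nullary.Decidable using (toSum)
open import Relation.Unary using (Pred; Decidable)
open import Relation.Binary.PropositionalEquality
  using (_≡_; refl; sym; trans; cong; cong-app; module ≡-Reasoning)

private
  variable
    k s t : ℕ

¬ExactlyTwo-constant : ∀ {x y z : Fin 3} → x ≡ y → y ≡ z →
                       ¬ ExactlyTwo (x ≡ one) (y ≡ two) (z ≡ three)
¬ExactlyTwo-constant refl refl (inj₁ (refl , () , _))
¬ExactlyTwo-constant refl refl (inj₂ (inj₁ (refl , _ , ())))
¬ExactlyTwo-constant refl refl (inj₂ (inj₂ (_ , refl , ())))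

ExactlyTwo-subst : ∀ {x y z x′ y′ z′ : Fin 3} → x ≡ x′ → y ≡ y′ → z ≡ z′ →
                   ExactlyTwo (x ≡ one) (y ≡ two) (z ≡ three) →
                   ExactlyTwo (x′ ≡ one) (y′ ≡ two) (z′ ≡ three)
ExactlyTwo-subst refl refl refl h = h

transpose-preserves : ∀ {n} {A : Set} (f : Fin n → A) {a b : Fin n} → f a ≡ f b →
                      ∀ r → f (Components.transpose a b r) ≡ f r
transpose-preserves f {a} {b} fa≡fb r with r ≟ a
... | yes refl = sym fa≡fb
... | no _ with r ≟ b
...   | yes refl = fa≡fb
...   | no _ = refl

transpose-matchˡ : ∀ {n} (a b : Fin n) → Components.transpose a b a ≡ b
transpose-matchˡ a b with a ≟ a
... | yes _ = refl
... | no a≢a = ⊥-elim (a≢a refl)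

punchIn-or-equal : ∀ {n} (c c′ : Fin (suc n)) → c ≡ c′ ⊎ ∃ λ j → punchIn c j ≡ c′
punchIn-or-equal c c′ with c ≟ c′
... | yes c≡c′ = inj₁ c≡c′
... | no c≢c′ = inj₂ (punchOut c≢c′ , punchIn-punchOut c≢c′)

-- Without function extensionality row-inj says nothing about pointwise equal rows, but
-- strongness does: swapping two such rows gives a π₁ that no (r , c) can tell apart
-- from π₂ = π₃ = id.
strongUSP-rows-distinct : (P : Puzzle k s) → IsStrongUSP P →
                          ∀ {a b} → (∀ c → row P a c ≡ row P b c) → a ≡ b
strongUSP-rows-distinct P usp {a} {b} a≈b with usp (transpose a b) id id
... | inj₁ (π₁≡id , _) = trans (sym (π₁≡id a)) (transpose-matchˡ a b)
... | inj₂ (r , c , exactlyTwo) =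
  ⊥-elim (¬ExactlyTwo-constant (transpose-preserves (λ x → row P x c) (a≈b c) r) refl exactlyTwo)

module Restriction (P : Puzzle k s) {e : Fin t → Fin s} (e-inj : Injective _≡_ _≡_ e) where

  restrict : Puzzle k t
  restrict = record { row = row P ∘ e ; row-inj = e-inj ∘ row-inj P }

  image? : ∀ r → Dec (∃ λ i → e i ≡ r)
  image? r = any? (λ i → e i ≟ r)

  extendFun : Perm t → Fin s → Fin s
  extendFun π r with image? r
  ... | yes (i , _) = e (π ⟨$⟩ʳ i)
  ... | no _ = r

  extend-image : ∀ π i → extendFun π (e i) ≡ e (π ⟨$⟩ʳ i)
  extend-image π i with image? (e i)
  ... | yes (j , ej≡ei) = cong (λ x → e (π ⟨$⟩ʳ x)) (e-inj ej≡ei)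
  ... | no i∉ = ⊥-elim (i∉ (i , refl))

  extend-outside : ∀ π {r} → ¬ (∃ λ i → e i ≡ r) → extendFun π r ≡ r
  extend-outside π {r} r∉ with image? r
  ... | yes r∈ = ⊥-elim (r∉ r∈)
  ... | no _ = refl

  -- Splitting on toSum (image? r) rather than on image? r leaves the image? r inside the
  -- extendFun terms unabstracted, so the lemmas above still apply to them.
  extendFun-inverse : ∀ π r → extendFun π (extendFun (flip π) r) ≡ r
  extendFun-inverse π r with toSum (image? r)
  ... | inj₁ (i , refl) = begin
    extendFun π (extendFun (flip π) (e i)) ≡⟨ cong (extendFun π) (extend-image (flip π) i) ⟩
    extendFun π (e (π ⟨$⟩ˡ i))             ≡⟨ extend-image π (π ⟨$⟩ˡ i) ⟩
    e (π ⟨$⟩ʳ (π ⟨$⟩ˡ i))                  ≡⟨ cong e (inverseʳ π) ⟩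
    e i                                    ∎
    where open ≡-Reasoning
  ... | inj₂ r∉ = trans (cong (extendFun π) (extend-outside (flip π) r∉)) (extend-outside π r∉)

  extend : Perm t → Perm s
  extend π = mk↔ₛ′ (extendFun π) (extendFun (flip π))
                   (extendFun-inverse π) (extendFun-inverse (flip π))

  extend-reflects-SamePerm : ∀ {π σ} → SamePerm (extend π) (extend σ) → SamePerm π σ
  extend-reflects-SamePerm {π} {σ} same i =
    e-inj (trans (sym (extend-image π i)) (trans (same (e i)) (extend-image σ i)))

  restrict-strongUSP : IsStrongUSP P → IsStrongUSP restrict
  restrict-strongUSP usp π₁ π₂ π₃ with usp (extend π₁) (extend π₂) (extend π₃)
  ... | inj₁ (same₁₂ , same₂₃) =
    inj₁ (extend-reflects-SamePerm same₁₂ , extend-reflects-SamePerm same₂₃)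
  ... | inj₂ (r , c , exactlyTwo) with toSum (image? r)
  ...   | inj₁ (i , refl) = inj₂ (i , c , ExactlyTwo-subst (entry π₁) (entry π₂) (entry π₃) exactlyTwo)
    where
    entry : ∀ π → row P (extendFun π (e i)) c ≡ row P (e (π ⟨$⟩ʳ i)) c
    entry π = cong (λ x → row P x c) (extend-image π i)
  ...   | inj₂ r∉ = ⊥-elim (¬ExactlyTwo-constant (fixed π₁ π₂) (fixed π₂ π₃) exactlyTwo)
    where
    fixed : ∀ π σ → row P (extendFun π r) c ≡ row P (extendFun σ r) c
    fixed π σ = cong (λ x → row P x c)
      (trans (extend-outside π r∉) (sym (extend-outside σ r∉)))

module ColumnDeletion (P : Puzzle (suc k) s) (usp : IsStrongUSP P)
                      (c : Fin (suc k)) {v : Fin 3} (constant : ∀ i → row P i c ≡ v) where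

  deleteColumnRow : Fin s → Row k
  deleteColumnRow i j = row P i (punchIn c j)

  deleteColumnRow-injective : Injective _≡_ _≡_ deleteColumnRow
  deleteColumnRow-injective {i} {i′} eq = strongUSP-rows-distinct P usp agree
    where
    agree : ∀ c′ → row P i c′ ≡ row P i′ c′
    agree c′ with punchIn-or-equal c c′
    ... | inj₁ refl = trans (constant i) (sym (constant i′))
    ... | inj₂ (j , refl) = cong-app eq j

  deleteColumn : Puzzle k s
  deleteColumn = record { row = deleteColumnRow ; row-inj = deleteColumnRow-injective }

  deleteColumn-strongUSP : IsStrongUSP deleteColumn
  deleteColumn-strongUSP π₁ π₂ π₃ with usp π₁ π₂ π₃
  ... | inj₁ same = inj₁ same
  ... | inj₂ (r , c′ , exactlyTwo) with punchIn-or-equal c c′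
  ...   | inj₂ (j , refl) = inj₂ (r , j , exactlyTwo)
  ...   | inj₁ refl = ⊥-elim (¬ExactlyTwo-constant (same π₁ π₂) (same π₂ π₃) exactlyTwo)
    where
    same : ∀ π σ → row P (π ⟨$⟩ʳ r) c ≡ row P (σ ⟨$⟩ʳ r) c
    same π σ = trans (constant _) (sym (constant _))

addIf : ∀ {A : Set} → Dec A → ℕ → ℕ
addIf (yes _) n = suc n
addIf (no _) n = n

count : ∀ {s} {P : Pred (Fin s) 0ℓ} → Decidable P → ℕ
count {ℕ.zero} _ = 0
count {suc s} P? = addIf (P? zero) (count (P? ∘ suc))

consIf : ∀ {A : Set} {n} (d : Dec A) → (Fin n → Fin s) → Fin (addIf d n) → Fin (suc s)
consIf (yes _) f zero = zero
consIf (yes _) f (suc i) = suc (f i)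
consIf (no _) f i = suc (f i)

enumerate : ∀ {s} {P : Pred (Fin s) 0ℓ} (P? : Decidable P) → Fin (count P?) → Fin s
enumerate {suc s} P? = consIf (P? zero) (enumerate (P? ∘ suc))

consIf-injective : ∀ {A : Set} {n} (d : Dec A) {f : Fin n → Fin s} →
                   Injective _≡_ _≡_ f → Injective _≡_ _≡_ (consIf d f)
consIf-injective (yes _) f-inj {zero} {zero} _ = refl
consIf-injective (yes _) f-inj {suc i} {suc j} eq = cong suc (f-inj (suc-injective eq))
consIf-injective (no _) f-inj eq = f-inj (suc-injective eq)

enumerate-injective : ∀ {s} {P : Pred (Fin s) 0ℓ} (P? : Decidable P) →
                      Injective _≡_ _≡_ (enumerate P?)
enumerate-injective {suc s} P? = consIf-injective (P? zero) (enumerate-injective (P? ∘ suc))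

consIf-sound : ∀ {n} {P : Pred (Fin (suc s)) 0ℓ} (d : Dec (P zero)) {f : Fin n → Fin s} →
               (∀ i → P (suc (f i))) → ∀ i → P (consIf d f i)
consIf-sound (yes p) f-sound zero = p
consIf-sound (yes p) f-sound (suc i) = f-sound i
consIf-sound (no _) f-sound i = f-sound i

enumerate-sound : ∀ {s} {P : Pred (Fin s) 0ℓ} (P? : Decidable P) → ∀ i → P (enumerate P? i)
enumerate-sound {suc s} {P} P? = consIf-sound {P = P} (P? zero) (enumerate-sound (P? ∘ suc))

fibre? : (g : Fin s → Fin 3) (v : Fin 3) → Decidable (λ i → g i ≡ v)
fibre? g v i = g i ≟ v

addIf-fibres : ∀ (w : Fin 3) a b c →
               addIf (w ≟ one) a ℕ.+ addIf (w ≟ two) b ℕ.+ addIf (w ≟ three) c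
               ≡ suc (a ℕ.+ b ℕ.+ c)
addIf-fibres zero a b c = refl
addIf-fibres (suc zero) a b c = cong (ℕ._+ c) (ℕ.+-suc a b)
addIf-fibres (suc (suc zero)) a b c = ℕ.+-suc (a ℕ.+ b) c

count-fibres : ∀ s (g : Fin s → Fin 3) →
               count (fibre? g one) ℕ.+ count (fibre? g two) ℕ.+ count (fibre? g three) ≡ s
count-fibres ℕ.zero g = refl
count-fibres (suc s) g =
  trans (addIf-fibres (g zero) _ _ _) (cong suc (count-fibres s (g ∘ suc)))

-- If all three were below ⌈s/3⌉ = (s+2)/3, then s + 3 ≤ 3⌈s/3⌉ ≤ s + 2.
ceil/3-pigeonhole : ∀ {a b c} → a ℕ.+ b ℕ.+ c ≡ s →
                    ceil/3 s ℕ.≤ a ⊎ ceil/3 s ℕ.≤ b ⊎ ceil/3 s ℕ.≤ c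
ceil/3-pigeonhole {s} {a} {b} {c} sum≡s
  with ceil/3 s ℕ.≤? a | ceil/3 s ℕ.≤? b | ceil/3 s ℕ.≤? c
... | yes t≤a | _ | _ = inj₁ t≤a
... | no _ | yes t≤b | _ = inj₂ (inj₁ t≤b)
... | no _ | no _ | yes t≤c = inj₂ (inj₂ t≤c)
... | no a<t | no b<t | no c<t = ⊥-elim (ℕ.<-irrefl refl s+3≤s+2)
  where
  open ℕ.≤-Reasoning
  ⌈s/3⌉ : ℕ
  ⌈s/3⌉ = ceil/3 s
  shift-sucs : ∀ x y z → suc (x ℕ.+ y ℕ.+ z ℕ.+ 2) ≡ suc x ℕ.+ suc y ℕ.+ suc z
  shift-sucs = solve-∀
  triple : ∀ n → n ℕ.+ n ℕ.+ n ≡ n ℕ.* 3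
  triple = solve-∀
  s+3≤s+2 : suc (s ℕ.+ 2) ℕ.≤ s ℕ.+ 2
  s+3≤s+2 = begin
    suc (s ℕ.+ 2)                 ≡⟨ cong (λ n → suc (n ℕ.+ 2)) sum≡s ⟨
    suc (a ℕ.+ b ℕ.+ c ℕ.+ 2)     ≡⟨ shift-sucs a b c ⟩
    suc a ℕ.+ suc b ℕ.+ suc c     ≤⟨ ℕ.+-mono-≤ (ℕ.+-mono-≤ (ℕ.≰⇒> a<t) (ℕ.≰⇒> b<t)) (ℕ.≰⇒> c<t) ⟩
    ⌈s/3⌉ ℕ.+ ⌈s/3⌉ ℕ.+ ⌈s/3⌉     ≡⟨ triple ⌈s/3⌉ ⟩
    ⌈s/3⌉ ℕ.* 3                   ≤⟨ m/n*n≤m (s ℕ.+ 2) 3 ⟩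
    s ℕ.+ 2                       ∎

enumerate-prefix : ∀ {P : Pred (Fin s) 0ℓ} (P? : Decidable P) → t ℕ.≤ count P? →
                   Σ (Fin t → Fin s) λ e → Injective _≡_ _≡_ e × (∀ i → P (e i))
enumerate-prefix P? t≤n =
  enumerate P? ∘ (λ i → inject≤ i t≤n) ,
  (λ eq → inject≤-injective t≤n t≤n _ _ (enumerate-injective P? eq)) ,
  (λ i → enumerate-sound P? (inject≤ i t≤n))

large-fibre : (g : Fin s → Fin 3) →
              ∃[ v ] Σ (Fin (ceil/3 s) → Fin s) λ e → Injective _≡_ _≡_ e × (∀ i → g (e i) ≡ v)
large-fibre {s} g with ceil/3-pigeonhole (count-fibres s g)
... | inj₁ t≤n = one , enumerate-prefix (fibre? g one) t≤n
... | inj₂ (inj₁ t≤n) = two , enumerate-prefix (fibre? g two) t≤n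
... | inj₂ (inj₂ t≤n) = three , enumerate-prefix (fibre? g three) t≤n

proposition4 : (k s : ℕ) → 1 < k → (P : Puzzle k s) → IsStrongUSP P →
    Σ (Puzzle (k ∸ 1) (ceil/3 s)) IsStrongUSP
proposition4 ℕ.zero _ () _ _
proposition4 (suc k) s _ P usp with large-fibre (λ i → row P i zero)
... | _ , e , e-inj , first-column-constant = deleteColumn , deleteColumn-strongUSP
  where
  open Restriction P e-inj
  open ColumnDeletion restrict (restrict-strongUSP usp) zero first-column-constant
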